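{- For any matroid $M$ of rank $r$ and any integer $n<r$, $w_n(M)\ge w_n(T^{r-n}(M))$.
   Context: For a matroid $M$ with rank function $\operatorname{rk}_M$ and lattice of flats $\mathcal{L}(M)$ (with Möbius function $\mu$ and bottom element $\hat0$), the $k$-th Whitney number of the first kind is $w_k(M)=\sum_{X}|\mu(\hat0,X)|$, the sum over flats $X$ of rank $k$. For $M$ of rank $r$, the $k$-th truncation $T^k(M)$ is the matroid on $E(M)$ of rank $r-k$ with rank function $\operatorname{rk}(X)=r-k$ if $\operatorname{rk}_M(X)\ge r-k$ and $\operatorname{rk}(X)=\operatorname{rk}_M(X)$ otherwise. -}

module Defs where

open import Data.Nat using (ℕ; zero; suc; _+_; _∸_; _≤_; _<_; _≤?_; _<?_)
open import Data.Integer using (ℤ; +_; -_) renaming (∣_∣ to abs)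
open import Data.Fin using (Fin)
open import Data.Fin.Subset using (Subset; _∈_; _∉_; _⊆_; _∪_; _∩_; ⁅_⁆; ∣_∣; ⊤; ⊥; inside; outside)
open import Data.Fin.Subset.Properties using (_∈?_; _⊆?_)
open import Data.Fin.Properties using (all?)
open import Data.Vec using (Vec; []; _∷_)
open import Data.Vec.Properties using (≡-dec)
import Data.Bool as B
open import Data.List using (List; []; _∷_; _++_; map; filter)
import Data.List as L
import Data.Nat.ListAction as NLA
import Data.Integer as ℤ
open import Data.Product using (_×_)
open import Relation.Binary.PropositionalEquality using (_≡_)
open import Relation.Nullary using (Dec; yes; no; ¬_; _×-dec_; _→-dec_; ¬?)

record Matroid (m : ℕ) : Set where
  field
    rk         : Subset m → ℕ
    rk-bounded : ∀ X → rk X ≤ ∣ X ∣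
    rk-mono    : ∀ {X Y} → X ⊆ Y → rk X ≤ rk Y
    rk-submod  : ∀ X Y → rk (X ∪ Y) + rk (X ∩ Y) ≤ rk X + rk Y
open Matroid public

rank : ∀ {m} → Matroid m → ℕ
rank M = rk M ⊤

RankFn : ℕ → Set
RankFn m = Subset m → ℕ

allSubsets : ∀ m → List (Subset m)
allSubsets zero = [] ∷ []
allSubsets (suc m) = map (outside ∷_) (allSubsets m) ++ map (inside ∷_) (allSubsets m)

_≟ˢ_ : ∀ {m} (X Y : Subset m) → Dec (X ≡ Y)
_≟ˢ_ = ≡-dec B._≟_

IsFlat : ∀ {m} → RankFn m → Subset m → Set
IsFlat r X = ∀ e → e ∉ X → r X < r (X ∪ ⁅ e ⁆)

isFlat? : ∀ {m} (r : RankFn m) (X : Subset m) → Dec (IsFlat r X)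
isFlat? r X = all? (λ e → ¬? (e ∈? X) →-dec (r X <? r (X ∪ ⁅ e ⁆)))

closure : ∀ {m} → RankFn m → Subset m → Subset m
closure {m} r X = Data.Vec.tabulate (λ e → B.if Dec.does (r (X ∪ ⁅ e ⁆) Data.Nat.≟ r X) then inside else outside)
  where import Data.Vec
        import Relation.Nullary as Dec
        import Data.Nat

bot : ∀ {m} → RankFn m → Subset m
bot r = closure r ⊥

flatsStrictlyBelow : ∀ {m} → RankFn m → Subset m → List (Subset m)
flatsStrictlyBelow {m} r X =
  filter (λ Y → isFlat? r Y ×-dec (bot r ⊆? Y) ×-dec (Y ⊆? X) ×-dec ¬? (Y ≟ˢ X)) (allSubsets m)

-- The fuel argument is only a termination device: strictly smaller flats have
-- strictly smaller cardinality, so fuel suc ∣ X ∣ suffices.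
μ-fuel : ∀ {m} → RankFn m → ℕ → Subset m → ℤ
μ-fuel r zero X = + 0
μ-fuel r (suc f) X with X ≟ˢ bot r
... | yes _ = + 1
... | no _  = - L.foldr ℤ._+_ (+ 0) (map (μ-fuel r f) (flatsStrictlyBelow r X))

μ : ∀ {m} → RankFn m → Subset m → ℤ
μ r X = μ-fuel r (suc ∣ X ∣) X

flatsOfRank : ∀ {m} → RankFn m → ℕ → List (Subset m)
flatsOfRank {m} r k =
  filter (λ X → isFlat? r X ×-dec (bot r ⊆? X) ×-dec (r X Data.Nat.≟ k)) (allSubsets m)
  where import Data.Nat

whitney₁ : ∀ {m} → RankFn m → ℕ → ℕ
whitney₁ r k = NLA.sum (map (λ X → abs (μ r X)) (flatsOfRank r k))

truncRk : ∀ {m} → Matroid m → ℕ → RankFn m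
truncRk M k X with (rank M ∸ k) ≤? rk M X
... | yes _ = rank M ∸ k
... | no _  = rk M X

-- Whitney's formula μ(0̂, X) = Σ (-1)^|A|, over the loopless sets A with cl A = X, turns every
-- Möbius value into a signed count of sets.  For 0 < n < r the truncation T = T^{r-n}(M) has rank n,
-- the same loops as M, and E as its only flat of rank n, so w_n(T) = |Σ (-1)^|A|| over the loopless A
-- with rk A ≥ n.  Fix a non-loop a: toggling a is a sign-reversing involution on any family of
-- loopless sets that is closed under it.  Applied to all loopless sets and to those with
-- rk (A ∪ {a}) ≤ n, it turns this sum into H = Σ (-1)^|A| over the loopless A with rk A = n and
-- a ∈ cl A, which by Whitney's formula is Σ μ(0̂, Y) over the flats Y of rank n containing a.
-- Hence w_n(T) = |H| ≤ w_n(M).  For n = 0 both Whitney numbers are 1.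

module Submission where

open import Algebra.Bundles using (CommutativeMonoid)
open import Level using (Level)
open import Data.Bool using (if_then_else_)
open import Data.Bool.Properties using (∨-identityʳ)
open import Data.Empty using (⊥-elim)
open import Data.Fin using (Fin; zero; suc)
open import Data.Fin.Properties using (¬∀⟶∃¬; all?)
open import Data.Fin.Subset
  using (Subset; _∈_; _∉_; _⊆_; _⊂_; _∪_; _∩_; ⁅_⁆; ∣_∣; ⊤; ⊥; inside; outside)
open import Data.Fin.Subset.Properties
  using ( _∈?_; _⊆?_; ⊆-antisym; ∪-identityʳ; drop-there; x∈p∪q⁺; x∈p∪q⁻; x∈p∩q⁺; x∈⁅x⁆; x∈⁅y⁆⇒x≡y
        ; p⊆p∪q; p∩q⊆p; p∩q⊆q; ∉⊥; ∈⊤; ⊆⊤; ∣⊥∣≡0; ∣⁅x⁆∣≡1; Empty-unique; p⊂q⇒∣p∣<∣q∣ )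
open import Data.Integer as ℤ using (ℤ; +_; -_)
import Data.Integer.Properties as ℤP
open import Data.List using (List; []; _∷_; _++_; map; filter; foldr; allFin)
open import Data.List.Properties using (map-++; map-∘)
open import Data.List.Membership.Propositional using () renaming (_∈_ to _∈ˡ_)
open import Data.List.Membership.Propositional.Properties using (∈-filter⁺; ∈-allFin)
open import Data.List.Relation.Unary.All using (All; []; _∷_)
open import Data.List.Relation.Unary.All.Properties using (all-filter)
open import Data.List.Relation.Unary.Any using (here; there)
open import Data.Nat using (ℕ; zero; suc; _+_; _∸_; _⊓_; _≤_; _<_; _≥_; z≤n; s≤s; _≟_; _≤?_; _<?_)
import Data.Nat.Properties as ℕP
open import Data.Product using (_×_; _,_; proj₁; proj₂; ∃)
open import Data.Sum using (_⊎_; inj₁; inj₂)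
open import Data.Unit using (tt)
open import Data.Vec using ([]; _∷_; here; there)
open import Data.Vec.Properties using (∷-injectiveʳ; lookup∘tabulate; []=⇒lookup; lookup⇒[]=; tabulate-cong)
open import Function using (_∘_)
open import Relation.Binary.PropositionalEquality as ≡ using (_≡_; _≢_)
open import Relation.Nullary using (Dec; does; yes; no; ¬_; ¬?; _×-dec_; _→-dec_)
open import Relation.Nullary.Decidable using (decidable-stable)
open import Relation.Unary using (Decidable)

open import Defs

-- Subsets of Fin m and sums over them

⊆-insert : ∀ {m} (X : Subset m) e → X ⊆ X ∪ ⁅ e ⁆
⊆-insert X e = p⊆p∪q ⁅ e ⁆

∈-insert : ∀ {m} (X : Subset m) e → e ∈ X ∪ ⁅ e ⁆
∈-insert X e = x∈p∪q⁺ (inj₂ (x∈⁅x⁆ e))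

insert-⊆ : ∀ {m} {X Y : Subset m} {e} → X ⊆ Y → e ∈ Y → X ∪ ⁅ e ⁆ ⊆ Y
insert-⊆ {X = X} {e = e} X⊆Y e∈Y x∈ with x∈p∪q⁻ X ⁅ e ⁆ x∈
... | inj₁ x∈X   = X⊆Y x∈X
... | inj₂ x∈⁅e⁆ rewrite x∈⁅y⁆⇒x≡y e x∈⁅e⁆ = e∈Y

⊆∧≢⇒⊂ : ∀ {m} {X Y : Subset m} → Y ⊆ X → Y ≢ X → Y ⊂ X
⊆∧≢⇒⊂ {m} {X} {Y} Y⊆X Y≢X
  with ¬∀⟶∃¬ m (λ e → e ∈ X → e ∈ Y) (λ e → e ∈? X →-dec e ∈? Y)
               (λ X⊆Y → Y≢X (⊆-antisym Y⊆X (X⊆Y _)))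
... | e , X⊈Y = Y⊆X , e , decidable-stable (e ∈? X) (λ e∉X → X⊈Y (⊥-elim ∘ e∉X)) , λ e∈Y → X⊈Y (λ _ → e∈Y)

x∉p⇒∣p∪⁅x⁆∣≡1+∣p∣ : ∀ {m} {X : Subset m} {e} → e ∉ X → ∣ X ∪ ⁅ e ⁆ ∣ ≡ suc ∣ X ∣
x∉p⇒∣p∪⁅x⁆∣≡1+∣p∣ {X = outside ∷ X} {zero}  _   = ≡.cong suc (≡.cong ∣_∣ (∪-identityʳ X))
x∉p⇒∣p∪⁅x⁆∣≡1+∣p∣ {X = inside  ∷ X} {zero}  e∉X = ⊥-elim (e∉X here)
x∉p⇒∣p∪⁅x⁆∣≡1+∣p∣ {X = outside ∷ X} {suc e} e∉X = x∉p⇒∣p∪⁅x⁆∣≡1+∣p∣ (e∉X ∘ there)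
x∉p⇒∣p∪⁅x⁆∣≡1+∣p∣ {X = inside  ∷ X} {suc e} e∉X = ≡.cong suc (x∉p⇒∣p∪⁅x⁆∣≡1+∣p∣ (e∉X ∘ there))

module SubsetSum {c ℓ} (CM : CommutativeMonoid c ℓ) where
  open CommutativeMonoid CM
  open import Relation.Binary.Reasoning.Setoid setoid
  open import Algebra.Properties.CommutativeSemigroup commutativeSemigroup using (interchange)

  ∑ : ∀ {m} → (Subset m → Carrier) → Carrier
  ∑ {zero}  f = f []
  ∑ {suc m} f = ∑ (f ∘ (outside ∷_)) ∙ ∑ (f ∘ (inside ∷_))

  private variable
    p q r : Level
    P : Set p
    Q : Set q
    R : Set r

  when : Dec P → Carrier → Carrier
  when (yes _) v = v
  when (no _)  _ = ε

  sumList : List Carrier → Carrier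
  sumList = foldr _∙_ ε

  when-true : (d : Dec P) → P → ∀ v → when d v ≡ v
  when-true (yes _) _  v = ≡.refl
  when-true (no ¬p) p v = ⊥-elim (¬p p)

  when-false : (d : Dec P) → ¬ P → ∀ v → when d v ≡ ε
  when-false (yes p) ¬p v = ⊥-elim (¬p p)
  when-false (no _)  _  v = ≡.refl

  when-⇔ : (d : Dec P) (e : Dec Q) → (P → Q) → (Q → P) → ∀ v → when d v ≡ when e v
  when-⇔ (yes _) (yes _) _ _ v = ≡.refl
  when-⇔ (yes p) (no ¬q) f _ v = ⊥-elim (¬q (f p))
  when-⇔ (no ¬p) (yes q) _ g v = ⊥-elim (¬p (g q))
  when-⇔ (no _)  (no _)  _ _ v = ≡.refl

  when-× : (d : Dec P) (e : Dec Q) → ∀ v → when d (when e v) ≡ when (d ×-dec e) v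
  when-× (yes _) (yes _) v = ≡.refl
  when-× (yes _) (no _)  v = ≡.refl
  when-× (no _)  _       v = ≡.refl

  when-comm : (d : Dec P) (e : Dec Q) → ∀ v → when d (when e v) ≡ when e (when d v)
  when-comm (yes _) (yes _) v = ≡.refl
  when-comm (yes _) (no _)  v = ≡.refl
  when-comm (no _)  (yes _) v = ≡.refl
  when-comm (no _)  (no _)  v = ≡.refl

  when-⊎ : (d : Dec P) (e : Dec Q) (f : Dec R) →
           (P → Q ⊎ R) → (Q → P) → (R → P) → (Q → ¬ R) →
           ∀ v → when d v ≈ when e v ∙ when f v
  when-⊎ d       (yes q) (yes r) _ _   _   q⇒¬r v = ⊥-elim (q⇒¬r q r)
  when-⊎ d       (yes q) (no _)  _ q⇒p _   _    v =
    trans (reflexive (when-true d (q⇒p q) v)) (sym (identityʳ v))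
  when-⊎ d       (no _)  (yes r) _ _   r⇒p _    v =
    trans (reflexive (when-true d (r⇒p r) v)) (sym (identityˡ v))
  when-⊎ (yes p) (no ¬q) (no ¬r) split _ _ _ v with split p
  ... | inj₁ q = ⊥-elim (¬q q)
  ... | inj₂ r = ⊥-elim (¬r r)
  when-⊎ (no _)  (no _)  (no _)  _ _ _ _ v = sym (identityˡ ε)

  ∑-cong : ∀ {m} {f g : Subset m → Carrier} → (∀ A → f A ≈ g A) → ∑ f ≈ ∑ g
  ∑-cong {zero}  f≈g = f≈g []
  ∑-cong {suc m} f≈g = ∙-cong (∑-cong (f≈g ∘ (outside ∷_))) (∑-cong (f≈g ∘ (inside ∷_)))

  ∑-zero : ∀ {m} (f : Subset m → Carrier) → (∀ A → f A ≈ ε) → ∑ f ≈ ε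
  ∑-zero {zero}  f f≈ε = f≈ε []
  ∑-zero {suc m} f f≈ε =
    trans (∙-cong (∑-zero _ (f≈ε ∘ (outside ∷_))) (∑-zero _ (f≈ε ∘ (inside ∷_)))) (identityˡ ε)

  ∑-distrib : ∀ {m} (f g : Subset m → Carrier) → ∑ (λ A → f A ∙ g A) ≈ ∑ f ∙ ∑ g
  ∑-distrib {zero}  f g = refl
  ∑-distrib {suc m} f g =
    trans (∙-cong (∑-distrib (f ∘ (outside ∷_)) (g ∘ (outside ∷_)))
                  (∑-distrib (f ∘ (inside ∷_)) (g ∘ (inside ∷_))))
          (interchange _ _ _ _)

  ∑-comm : ∀ {m k} (h : Subset m → Subset k → Carrier) →
           ∑ (λ A → ∑ (h A)) ≈ ∑ (λ B → ∑ (λ A → h A B))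
  ∑-comm {zero}  h = refl
  ∑-comm {suc m} h =
    trans (∙-cong (∑-comm (h ∘ (outside ∷_))) (∑-comm (h ∘ (inside ∷_))))
          (sym (∑-distrib (λ B → ∑ (λ A → h (outside ∷ A) B)) (λ B → ∑ (λ A → h (inside ∷ A) B))))

  ∑-supported : ∀ {m} (Z : Subset m) (f : Subset m → Carrier) →
                (∀ A → A ≢ Z → f A ≈ ε) → ∑ f ≈ f Z
  ∑-supported {zero}  []            f f≈ε = refl
  ∑-supported {suc m} (outside ∷ Z) f f≈ε =
    trans (∙-cong (∑-supported Z _ (λ A A≢Z → f≈ε _ (A≢Z ∘ ∷-injectiveʳ)))
                  (∑-zero (f ∘ (inside ∷_)) (λ A → f≈ε _ λ ())))
          (identityʳ _)
  ∑-supported {suc m} (inside ∷ Z)  f f≈ε =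
    trans (∙-cong (∑-zero (f ∘ (outside ∷_)) (λ A → f≈ε _ λ ()))
                  (∑-supported Z _ (λ A A≢Z → f≈ε _ (A≢Z ∘ ∷-injectiveʳ))))
          (identityˡ _)

  ∑-when-≡ : ∀ {m} (Z : Subset m) (f : Subset m → Carrier) → ∑ (λ Y → when (Z ≟ˢ Y) (f Y)) ≈ f Z
  ∑-when-≡ Z f = trans (∑-supported Z (λ Y → when (Z ≟ˢ Y) (f Y)) (λ Y Y≢Z → reflexive (when-false (Z ≟ˢ Y) (Y≢Z ∘ ≡.sym) (f Y))))
                       (reflexive (when-true (Z ≟ˢ Z) ≡.refl (f Z)))

  ∑-fibres : ∀ {m k} (φ : Subset m → Subset k) (g : Subset k → Subset m → Carrier) →
             ∑ (λ Y → ∑ (λ A → when (φ A ≟ˢ Y) (g Y A))) ≈ ∑ (λ A → g (φ A) A)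
  ∑-fibres φ g = trans (∑-comm (λ Y A → when (φ A ≟ˢ Y) (g Y A))) (∑-cong (λ A → ∑-when-≡ (φ A) (λ Y → g Y A)))

  when-∑ : ∀ {p m} {P : Set p} (d : Dec P) (f : Subset m → Carrier) → when d (∑ f) ≈ ∑ (λ A → when d (f A))
  when-∑         (yes _) f = refl
  when-∑ {m = m} (no _)  f = sym (∑-zero {m} (λ _ → ε) (λ _ → refl))

  ∑-split : ∀ {m} (a : Fin m) (f : Subset m → Carrier) →
            ∑ f ≈ ∑ (λ A → when (¬? (a ∈? A)) (f A ∙ f (A ∪ ⁅ a ⁆)))
  ∑-split {suc m} zero f = begin
    ∑ (f ∘ (outside ∷_)) ∙ ∑ (f ∘ (inside ∷_))
      ≈⟨ ∙-cong refl (∑-cong (λ A → reflexive (≡.cong (f ∘ (inside ∷_)) (≡.sym (∪-identityʳ A))))) ⟩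
    ∑ (f ∘ (outside ∷_)) ∙ ∑ (λ A → f (inside ∷ (A ∪ ⊥)))
      ≈⟨ sym (∑-distrib (f ∘ (outside ∷_)) (λ A → f (inside ∷ (A ∪ ⊥)))) ⟩
    ∑ (λ A → f (outside ∷ A) ∙ f (inside ∷ (A ∪ ⊥)))
      ≈⟨ sym (identityʳ _) ⟩
    ∑ (λ A → f (outside ∷ A) ∙ f (inside ∷ (A ∪ ⊥))) ∙ ε
      ≈⟨ ∙-cong refl (sym (∑-zero {m} (λ _ → ε) (λ _ → refl))) ⟩
    ∑ (λ A → f (outside ∷ A) ∙ f (inside ∷ (A ∪ ⊥))) ∙ ∑ {m} (λ _ → ε)
      ∎
  ∑-split {suc m} (suc a) f = ∙-cong (shift outside) (shift inside)
    where
    shift : ∀ x → ∑ (f ∘ (x ∷_)) ≈ ∑ (λ A → when (¬? (suc a ∈? (x ∷ A))) (f (x ∷ A) ∙ f ((x ∷ A) ∪ ⁅ suc a ⁆)))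
    shift x = trans (∑-split a (f ∘ (x ∷_)))
      (∑-cong (λ A → reflexive (≡.trans
        (when-⇔ (¬? (a ∈? A)) (¬? (suc a ∈? (x ∷ A))) (λ a∉A → a∉A ∘ drop-there) (λ a∉xA → a∉xA ∘ there) _)
        (≡.cong (λ y → when (¬? (suc a ∈? (x ∷ A))) (f (x ∷ A) ∙ f (y ∷ (A ∪ ⁅ a ⁆)))) (≡.sym (∨-identityʳ x))))))

  sumList-++ : ∀ xs ys → sumList (xs ++ ys) ≈ sumList xs ∙ sumList ys
  sumList-++ []       ys = sym (identityˡ _)
  sumList-++ (x ∷ xs) ys = trans (∙-cong refl (sumList-++ xs ys)) (sym (assoc _ _ _))

  sumList-allSubsets : ∀ {m} (f : Subset m → Carrier) → sumList (map f (allSubsets m)) ≈ ∑ f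
  sumList-allSubsets {zero}  f = identityʳ _
  sumList-allSubsets {suc m} f = begin
    sumList (map f (map (outside ∷_) (allSubsets m) ++ map (inside ∷_) (allSubsets m)))
      ≡⟨ ≡.cong sumList (map-++ f (map (outside ∷_) (allSubsets m)) (map (inside ∷_) (allSubsets m))) ⟩
    sumList (map f (map (outside ∷_) (allSubsets m)) ++ map f (map (inside ∷_) (allSubsets m)))
      ≈⟨ sumList-++ (map f (map (outside ∷_) (allSubsets m))) (map f (map (inside ∷_) (allSubsets m))) ⟩
    sumList (map f (map (outside ∷_) (allSubsets m))) ∙ sumList (map f (map (inside ∷_) (allSubsets m)))
      ≡⟨ ≡.sym (≡.cong₂ (λ xs ys → sumList xs ∙ sumList ys) (map-∘ (allSubsets m)) (map-∘ (allSubsets m))) ⟩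
    sumList (map (f ∘ (outside ∷_)) (allSubsets m)) ∙ sumList (map (f ∘ (inside ∷_)) (allSubsets m))
      ≈⟨ ∙-cong (sumList-allSubsets (f ∘ (outside ∷_))) (sumList-allSubsets (f ∘ (inside ∷_))) ⟩
    ∑ f ∎

  sumList-filter : ∀ {a p} {X : Set a} {P : X → Set p} (P? : Decidable P) (f : X → Carrier) xs →
                   sumList (map f (filter P? xs)) ≈ sumList (map (λ x → when (P? x) (f x)) xs)
  sumList-filter P? f []       = refl
  sumList-filter P? f (x ∷ xs) with P? x
  ... | yes _ = ∙-cong refl (sumList-filter P? f xs)
  ... | no _  = trans (sumList-filter P? f xs) (sym (identityˡ _))

  ∑-filter : ∀ {m p} {P : Subset m → Set p} (P? : Decidable P) (f : Subset m → Carrier) →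
             sumList (map f (filter P? (allSubsets m))) ≈ ∑ (λ A → when (P? A) (f A))
  ∑-filter {m} P? f = trans (sumList-filter P? f (allSubsets m)) (sumList-allSubsets (λ A → when (P? A) (f A)))

open SubsetSum ℤP.+-0-commutativeMonoid
module ℕSum = SubsetSum ℕP.+-0-commutativeMonoid

∑-mono-≤ : ∀ {m} {f g : Subset m → ℕ} → (∀ A → f A ≤ g A) → ℕSum.∑ f ≤ ℕSum.∑ g
∑-mono-≤ {zero}  f≤g = f≤g []
∑-mono-≤ {suc m} f≤g = ℕP.+-mono-≤ (∑-mono-≤ (f≤g ∘ (outside ∷_))) (∑-mono-≤ (f≤g ∘ (inside ∷_)))

∣∑∣≤∑∣∣ : ∀ {m} (f : Subset m → ℤ) → ℤ.∣ ∑ f ∣ ≤ ℕSum.∑ (λ A → ℤ.∣ f A ∣)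
∣∑∣≤∑∣∣ {zero}  f = ℕP.≤-refl
∣∑∣≤∑∣∣ {suc m} f = ℕP.≤-trans (ℤP.∣i+j∣≤∣i∣+∣j∣ (∑ (f ∘ (outside ∷_))) _)
  (ℕP.+-mono-≤ (∣∑∣≤∑∣∣ (f ∘ (outside ∷_))) (∣∑∣≤∑∣∣ (f ∘ (inside ∷_))))

∣when∣≤∣∣ : ∀ {p} {P : Set p} (d : Dec P) v → ℤ.∣ when d v ∣ ≤ ℤ.∣ v ∣
∣when∣≤∣∣ (yes _) v = ℕP.≤-refl
∣when∣≤∣∣ (no _)  v = z≤n

-1^_ : ℕ → ℤ
-1^ zero  = + 1
-1^ suc k = - (-1^ k)

alternating-∑≡0 : ∀ {m c} {C : Subset m → Set c} (a : Fin m) (C? : Decidable C) →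
                  (∀ A → a ∉ A → C A → C (A ∪ ⁅ a ⁆)) → (∀ A → a ∉ A → C (A ∪ ⁅ a ⁆) → C A) →
                  ∑ (λ A → when (C? A) (-1^ ∣ A ∣)) ≡ + 0
alternating-∑≡0 a C? up down =
  ≡.trans (∑-split a _) (∑-zero _ cancel)
  where
  when-neg : ∀ {p} {P : Set p} (d : Dec P) v → when d (- v) ≡ - when d v
  when-neg (yes _) v = ≡.refl
  when-neg (no _)  v = ≡.refl
  cancel : ∀ A → when (¬? (a ∈? A)) (when (C? A) (-1^ ∣ A ∣) ℤ.+ when (C? (A ∪ ⁅ a ⁆)) (-1^ ∣ A ∪ ⁅ a ⁆ ∣)) ≡ + 0
  cancel A with a ∈? A
  ... | yes _   = ≡.refl
  ... | no  a∉A rewrite x∉p⇒∣p∪⁅x⁆∣≡1+∣p∣ a∉A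
                      | when-⇔ (C? (A ∪ ⁅ a ⁆)) (C? A) (down A a∉A) (up A a∉A) (- (-1^ ∣ A ∣))
                      | when-neg (C? A) (-1^ ∣ A ∣) = ℤP.+-inverseʳ (when (C? A) (-1^ ∣ A ∣))

-- Closure in a matroid

module _ {m} (r : RankFn m) {X : Subset m} {e : Fin m} where

  private
    inside-if⁻ : ∀ {p} {P : Set p} (d : Dec P) → (if does d then inside else outside) ≡ inside → P
    inside-if⁻ (yes p) _ = p
    inside-if⁻ (no _)  ()

    inside-if⁺ : ∀ {p} {P : Set p} (d : Dec P) → P → (if does d then inside else outside) ≡ inside
    inside-if⁺ (yes _) _ = ≡.refl
    inside-if⁺ (no ¬p) p = ⊥-elim (¬p p)

  ∈-closure⁻ : e ∈ closure r X → r (X ∪ ⁅ e ⁆) ≡ r X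
  ∈-closure⁻ e∈ = inside-if⁻ (r (X ∪ ⁅ e ⁆) ≟ r X) (≡.trans (≡.sym (lookup∘tabulate _ e)) ([]=⇒lookup e∈))

  ∈-closure⁺ : r (X ∪ ⁅ e ⁆) ≡ r X → e ∈ closure r X
  ∈-closure⁺ eq = lookup⇒[]= e _ (≡.trans (lookup∘tabulate _ e) (inside-if⁺ (r (X ∪ ⁅ e ⁆) ≟ r X) eq))

closure-cong : ∀ {m} {r s : RankFn m} {X} → r X ≡ s X → (∀ e → r (X ∪ ⁅ e ⁆) ≡ s (X ∪ ⁅ e ⁆)) →
               closure r X ≡ closure s X
closure-cong rX≡sX r≡s = tabulate-cong (λ e →
  ≡.cong₂ (λ u v → if does (u ≟ v) then inside else outside) (r≡s e) rX≡sX)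

module MatroidClosure {m} (M : Matroid m) where

  cl : Subset m → Subset m
  cl = closure (rk M)

  loops : Subset m
  loops = bot (rk M)

  rk-∅ : rk M ⊥ ≡ 0
  rk-∅ = ℕP.n≤0⇒n≡0 (ℕP.≤-trans (rk-bounded M ⊥) (ℕP.≤-reflexive (∣⊥∣≡0 m)))

  rk-insert-≤ : ∀ X e → rk M (X ∪ ⁅ e ⁆) ≤ suc (rk M X)
  rk-insert-≤ X e = begin
    rk M (X ∪ ⁅ e ⁆)                         ≤⟨ ℕP.m≤m+n _ _ ⟩
    rk M (X ∪ ⁅ e ⁆) + rk M (X ∩ ⁅ e ⁆)     ≤⟨ rk-submod M X ⁅ e ⁆ ⟩
    rk M X + rk M ⁅ e ⁆                      ≤⟨ ℕP.+-monoʳ-≤ (rk M X) (rk-bounded M ⁅ e ⁆) ⟩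
    rk M X + ∣ ⁅ e ⁆ ∣                       ≡⟨ ≡.cong (_+_ (rk M X)) (∣⁅x⁆∣≡1 e) ⟩
    rk M X + 1                               ≡⟨ ℕP.+-comm (rk M X) 1 ⟩
    suc (rk M X)                             ∎
    where open ℕP.≤-Reasoning

  rk-insert-∈ : ∀ {X e} → e ∈ X → rk M (X ∪ ⁅ e ⁆) ≡ rk M X
  rk-insert-∈ {X} {e} e∈X = ≡.cong (rk M) (⊆-antisym (insert-⊆ (λ x∈ → x∈) e∈X) (⊆-insert X e))

  rk-insert-absorb : ∀ {X Z} e → X ⊆ Z → rk M (X ∪ ⁅ e ⁆) ≡ rk M X → rk M (Z ∪ ⁅ e ⁆) ≡ rk M Z
  rk-insert-absorb {X} {Z} e X⊆Z same =
    ℕP.≤-antisym (ℕP.+-cancelʳ-≤ (rk M X) _ _ (begin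
      rk M (Z ∪ ⁅ e ⁆) + rk M X
        ≤⟨ ℕP.+-mono-≤ (rk-mono M (insert-⊆ (x∈p∪q⁺ ∘ inj₁) (x∈p∪q⁺ (inj₂ (∈-insert X e)))))
                       (rk-mono M (λ x∈X → x∈p∩q⁺ (X⊆Z x∈X , ⊆-insert X e x∈X))) ⟩
      rk M (Z ∪ (X ∪ ⁅ e ⁆)) + rk M (Z ∩ (X ∪ ⁅ e ⁆))
        ≤⟨ rk-submod M Z (X ∪ ⁅ e ⁆) ⟩
      rk M Z + rk M (X ∪ ⁅ e ⁆)
        ≡⟨ ≡.cong (_+_ (rk M Z)) same ⟩
      rk M Z + rk M X ∎))
    (rk-mono M (⊆-insert Z e))
    where open ℕP.≤-Reasoning

  ⊆-closure : ∀ X → X ⊆ cl X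
  ⊆-closure X e∈X = ∈-closure⁺ (rk M) (rk-insert-∈ e∈X)

  closure-least : ∀ {X Y} → IsFlat (rk M) Y → X ⊆ Y → cl X ⊆ Y
  closure-least {X} {Y} flat X⊆Y {e} e∈clX with e ∈? Y
  ... | yes e∈Y = e∈Y
  ... | no  e∉Y = ⊥-elim (ℕP.<-irrefl (≡.sym (rk-insert-absorb e X⊆Y (∈-closure⁻ (rk M) e∈clX))) (flat e e∉Y))

  insertAll : Subset m → List (Fin m) → Subset m
  insertAll = foldr (λ e Y → Y ∪ ⁅ e ⁆)

  ⊆-insertAll : ∀ X es → X ⊆ insertAll X es
  ⊆-insertAll X []       x∈X = x∈X
  ⊆-insertAll X (e ∷ es) x∈X = ⊆-insert _ e (⊆-insertAll X es x∈X)

  ∈-insertAll : ∀ X {es e} → e ∈ˡ es → e ∈ insertAll X es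
  ∈-insertAll X {e ∷ es} (here ≡.refl) = ∈-insert _ e
  ∈-insertAll X {f ∷ es} (there e∈es)  = ⊆-insert _ f (∈-insertAll X e∈es)

  rk-insertAll : ∀ X {es} → All (_∈ cl X) es → rk M (insertAll X es) ≡ rk M X
  rk-insertAll X []                    = ≡.refl
  rk-insertAll X {e ∷ es} (e∈cl ∷ es∈cl) =
    ≡.trans (rk-insert-absorb e (⊆-insertAll X es) (∈-closure⁻ (rk M) e∈cl)) (rk-insertAll X es∈cl)

  -- cl X lies in X with its closure elements inserted, which have rank rk X
  rk-closure : ∀ X → rk M (cl X) ≡ rk M X
  rk-closure X = ℕP.≤-antisym
    (ℕP.≤-trans (rk-mono M (λ {e} e∈cl → ∈-insertAll X (∈-filter⁺ (_∈? cl X) (∈-allFin e) e∈cl)))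
                (ℕP.≤-reflexive (rk-insertAll X (all-filter (_∈? cl X) (allFin m)))))
    (rk-mono M (⊆-closure X))

  closure-isFlat : ∀ X → IsFlat (rk M) (cl X)
  closure-isFlat X e e∉clX = begin-strict
    rk M (cl X)          ≡⟨ rk-closure X ⟩
    rk M X               <⟨ ℕP.≤∧≢⇒< (rk-mono M (⊆-insert X e)) (e∉clX ∘ ∈-closure⁺ (rk M) ∘ ≡.sym) ⟩
    rk M (X ∪ ⁅ e ⁆)     ≤⟨ rk-mono M (insert-⊆ (⊆-insert (cl X) e ∘ ⊆-closure X) (∈-insert (cl X) e)) ⟩
    rk M (cl X ∪ ⁅ e ⁆)  ∎
    where open ℕP.≤-Reasoning

  loops⊆closure : ∀ X → loops ⊆ cl X
  loops⊆closure X = closure-least (closure-isFlat X) (⊥-elim ∘ ∉⊥)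

  flat-of-full-rank : ∀ {X} → IsFlat (rk M) X → rk M X ≡ rank M → X ≡ ⊤
  flat-of-full-rank {X} flat full = ⊆-antisym ⊆⊤ (λ {e} _ → decidable-stable (e ∈? X) (λ e∉X →
    ℕP.<-irrefl full (ℕP.<-≤-trans (flat e e∉X) (rk-mono M ⊆⊤))))

  rank-0⇒⊆loops : ∀ {X} → rk M X ≡ 0 → X ⊆ loops
  rank-0⇒⊆loops {X} rk0 {e} e∈X = ∈-closure⁺ (rk M) (≡.trans
    (ℕP.n≤0⇒n≡0 (ℕP.≤-trans (rk-mono M (insert-⊆ (⊥-elim ∘ ∉⊥) e∈X)) (ℕP.≤-reflexive rk0)))
    (≡.sym rk-∅))

  nonloop : 0 < rank M → ∃ λ a → a ∉ loops
  nonloop 0<r with ⊆∧≢⇒⊂ (⊆⊤ {p = loops}) (λ loops≡⊤ →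
                     ℕP.<-irrefl (≡.trans (≡.sym rk-∅) (≡.trans (≡.sym (rk-closure ⊥)) (≡.cong (rk M) loops≡⊤))) 0<r)
  ... | _ , a , _ , a∉loops = a , a∉loops

-- Whitney's formula for the Möbius function

module Whitney {m} (M : Matroid m) where
  open MatroidClosure M
  open ≡.≡-Reasoning

  Loopless : Subset m → Set
  Loopless A = ∀ e → e ∈ A → e ∉ loops

  loopless? : Decidable Loopless
  loopless? A = all? (λ e → e ∈? A →-dec ¬? (e ∈? loops))

  loopless-⊆ : ∀ {A B} → Loopless B → A ⊆ B → Loopless A
  loopless-⊆ ll A⊆B e e∈A = ll e (A⊆B e∈A)

  loopless-insert : ∀ {A a} → a ∉ loops → Loopless A → Loopless (A ∪ ⁅ a ⁆)
  loopless-insert {A} {a} a∉loops ll e e∈ with x∈p∪q⁻ A ⁅ a ⁆ e∈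
  ... | inj₁ e∈A   = ll e e∈A
  ... | inj₂ e∈⁅a⁆ rewrite x∈⁅y⁆⇒x≡y a e∈⁅a⁆ = a∉loops

  weight : Subset m → ℤ
  weight A = when (loopless? A) (-1^ ∣ A ∣)

  closureSum : Subset m → ℤ
  closureSum X = ∑ (λ A → when (cl A ≟ˢ X) (weight A))

  ∑-closureSum : ∀ {p} {P : Subset m → Set p} (P? : Decidable P) →
                 ∑ (λ Y → when (P? Y) (closureSum Y)) ≡ ∑ (λ A → when (P? (cl A)) (weight A))
  ∑-closureSum P? = begin
    ∑ (λ Y → when (P? Y) (closureSum Y))
      ≡⟨ ∑-cong (λ Y → when-∑ (P? Y) (λ A → when (cl A ≟ˢ Y) (weight A))) ⟩
    ∑ (λ Y → ∑ (λ A → when (P? Y) (when (cl A ≟ˢ Y) (weight A))))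
      ≡⟨ ∑-cong (λ Y → ∑-cong (λ A → when-comm (P? Y) (cl A ≟ˢ Y) (weight A))) ⟩
    ∑ (λ Y → ∑ (λ A → when (cl A ≟ˢ Y) (when (P? Y) (weight A))))
      ≡⟨ ∑-fibres cl (λ Y A → when (P? Y) (weight A)) ⟩
    ∑ (λ A → when (P? (cl A)) (weight A)) ∎

  ∑-weight≡0 : ∀ {a} → a ∉ loops → ∀ {q} {Q : Subset m → Set q} (Q? : Decidable Q) →
               (∀ A → a ∉ A → Q A → Q (A ∪ ⁅ a ⁆)) → (∀ A → a ∉ A → Q (A ∪ ⁅ a ⁆) → Q A) →
               ∑ (λ A → when (Q? A) (weight A)) ≡ + 0
  ∑-weight≡0 {a} a∉loops Q? up down = begin
    ∑ (λ A → when (Q? A) (weight A))                          ≡⟨ ∑-cong (λ A → when-× (Q? A) (loopless? A) _) ⟩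
    ∑ (λ A → when (Q? A ×-dec loopless? A) (-1^ ∣ A ∣))      ≡⟨ alternating-∑≡0 a (λ A → Q? A ×-dec loopless? A)
                                                                  (λ A a∉A (q , ll) → up A a∉A q , loopless-insert a∉loops ll)
                                                                  (λ A a∉A (q , ll) → down A a∉A q , loopless-⊆ ll (⊆-insert A a)) ⟩
    + 0                                                       ∎

  closureSum-loops : closureSum loops ≡ + 1
  closureSum-loops = begin
    closureSum loops
      ≡⟨ ∑-supported ⊥ _ vanish ⟩
    when (loops ≟ˢ loops) (weight ⊥)
      ≡⟨ when-true (loops ≟ˢ loops) ≡.refl _ ⟩
    when (loopless? ⊥) (-1^ ∣ ⊥ {m} ∣)
      ≡⟨ when-true (loopless? ⊥) (λ e → ⊥-elim ∘ ∉⊥) _ ⟩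
    -1^ ∣ ⊥ {m} ∣
      ≡⟨ ≡.cong -1^_ (∣⊥∣≡0 m) ⟩
    + 1 ∎
    where
    vanish : ∀ A → A ≢ ⊥ → when (cl A ≟ˢ loops) (weight A) ≡ + 0
    vanish A A≢⊥ = ≡.trans (when-× (cl A ≟ˢ loops) (loopless? A) _) (when-false (cl A ≟ˢ loops ×-dec loopless? A)
      (λ (clA≡loops , ll) → A≢⊥ (Empty-unique (λ (e , e∈A) → ll e e∈A (≡.subst (e ∈_) clA≡loops (⊆-closure A e∈A)))))
      _)

  flatBelow? : ∀ X Y → Dec (IsFlat (rk M) Y × loops ⊆ Y × Y ⊆ X)
  flatBelow? X Y = isFlat? (rk M) Y ×-dec (loops ⊆? Y) ×-dec (Y ⊆? X)

  flatStrictlyBelow? : ∀ X Y → Dec (IsFlat (rk M) Y × loops ⊆ Y × Y ⊆ X × Y ≢ X)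
  flatStrictlyBelow? X Y = isFlat? (rk M) Y ×-dec (loops ⊆? Y) ×-dec (Y ⊆? X) ×-dec ¬? (Y ≟ˢ X)

  ∑-flatBelow : ∀ {X} → IsFlat (rk M) X →
                ∑ (λ Y → when (flatBelow? X Y) (closureSum Y)) ≡ ∑ (λ A → when (A ⊆? X) (weight A))
  ∑-flatBelow {X} flat = ≡.trans (∑-closureSum (flatBelow? X)) (∑-cong (λ A →
    when-⇔ (flatBelow? X (cl A)) (A ⊆? X)
      (λ (_ , _ , clA⊆X) → clA⊆X ∘ ⊆-closure A)
      (λ A⊆X → closure-isFlat A , loops⊆closure A , closure-least flat A⊆X)
      (weight A)))

  closureSum-recursion : ∀ {X} → IsFlat (rk M) X → loops ⊆ X → X ≢ loops →
                         closureSum X ≡ - ∑ (λ Y → when (flatStrictlyBelow? X Y) (closureSum Y))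
  closureSum-recursion {X} flat loops⊆X X≢loops = inverseˡ-unique _ _ (begin
    closureSum X ℤ.+ ∑ (λ Y → when (flatStrictlyBelow? X Y) (closureSum Y))
      ≡⟨ ≡.cong (ℤ._+ strictSum) (≡.sym (∑-when-≡ X closureSum)) ⟩
    ∑ (λ Y → when (X ≟ˢ Y) (closureSum Y)) ℤ.+ ∑ (λ Y → when (flatStrictlyBelow? X Y) (closureSum Y))
      ≡⟨ ≡.sym (∑-distrib (λ Y → when (X ≟ˢ Y) (closureSum Y)) (λ Y → when (flatStrictlyBelow? X Y) (closureSum Y))) ⟩
    ∑ (λ Y → when (X ≟ˢ Y) (closureSum Y) ℤ.+ when (flatStrictlyBelow? X Y) (closureSum Y))
      ≡⟨ ≡.sym (∑-cong (λ Y → below≡equal+strictlyBelow Y (closureSum Y))) ⟩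
    ∑ (λ Y → when (flatBelow? X Y) (closureSum Y))
      ≡⟨ ∑-flatBelow flat ⟩
    ∑ (λ A → when (A ⊆? X) (weight A))
      ≡⟨ subsets-vanish (proj₂ (⊆∧≢⇒⊂ loops⊆X (X≢loops ∘ ≡.sym))) ⟩
    + 0 ∎)
    where
    open import Algebra.Properties.AbelianGroup ℤP.+-0-abelianGroup using (inverseˡ-unique)
    strictSum = ∑ (λ Y → when (flatStrictlyBelow? X Y) (closureSum Y))
    subsets-vanish : (∃ λ e → e ∈ X × e ∉ loops) → ∑ (λ A → when (A ⊆? X) (weight A)) ≡ + 0
    subsets-vanish (e , e∈X , e∉loops) =
      ∑-weight≡0 e∉loops (_⊆? X) (λ A _ A⊆X → insert-⊆ A⊆X e∈X) (λ A _ A+e⊆X → A+e⊆X ∘ ⊆-insert A e)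
    below≡equal+strictlyBelow : ∀ Y v →
      when (flatBelow? X Y) v ≡ when (X ≟ˢ Y) v ℤ.+ when (flatStrictlyBelow? X Y) v
    below≡equal+strictlyBelow Y = when-⊎ (flatBelow? X Y) (X ≟ˢ Y) (flatStrictlyBelow? X Y)
      split
      (λ { ≡.refl → flat , loops⊆X , (λ x∈X → x∈X) })
      (λ (flatY , loops⊆Y , Y⊆X , _) → flatY , loops⊆Y , Y⊆X)
      (λ X≡Y (_ , _ , _ , Y≢X) → Y≢X (≡.sym X≡Y))
      where
      split : IsFlat (rk M) Y × loops ⊆ Y × Y ⊆ X → X ≡ Y ⊎ (IsFlat (rk M) Y × loops ⊆ Y × Y ⊆ X × Y ≢ X)
      split (flatY , loops⊆Y , Y⊆X) with X ≟ˢ Y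
      ... | yes X≡Y = inj₁ X≡Y
      ... | no  X≢Y = inj₂ (flatY , loops⊆Y , Y⊆X , X≢Y ∘ ≡.sym)

  μ-fuel≡closureSum : ∀ f {X} → IsFlat (rk M) X → loops ⊆ X → ∣ X ∣ < f → μ-fuel (rk M) f X ≡ closureSum X
  μ-fuel≡closureSum (suc f) {X} flat loops⊆X ∣X∣<1+f with X ≟ˢ bot (rk M)
  ... | yes ≡.refl  = ≡.sym closureSum-loops
  ... | no  X≢loops = begin
    - sumList (map (μ-fuel (rk M) f) (flatsStrictlyBelow (rk M) X))
      ≡⟨ ≡.cong -_ (∑-filter (flatStrictlyBelow? X) (μ-fuel (rk M) f)) ⟩
    - ∑ (λ Y → when (flatStrictlyBelow? X Y) (μ-fuel (rk M) f Y))
      ≡⟨ ≡.cong -_ (∑-cong induction) ⟩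
    - ∑ (λ Y → when (flatStrictlyBelow? X Y) (closureSum Y))
      ≡⟨ ≡.sym (closureSum-recursion flat loops⊆X X≢loops) ⟩
    closureSum X ∎
    where
    induction : ∀ Y → when (flatStrictlyBelow? X Y) (μ-fuel (rk M) f Y) ≡ when (flatStrictlyBelow? X Y) (closureSum Y)
    induction Y with flatStrictlyBelow? X Y
    ... | yes (flatY , loops⊆Y , Y⊆X , Y≢X) = μ-fuel≡closureSum f flatY loops⊆Y
            (ℕP.<-≤-trans (p⊂q⇒∣p∣<∣q∣ (⊆∧≢⇒⊂ Y⊆X Y≢X)) (ℕP.≤-pred ∣X∣<1+f))
    ... | no _ = ≡.refl

  μ≡closureSum : ∀ {X} → IsFlat (rk M) X → loops ⊆ X → μ (rk M) X ≡ closureSum X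
  μ≡closureSum flat loops⊆X = μ-fuel≡closureSum _ flat loops⊆X ℕP.≤-refl

  flatOfRank? : ∀ k X → Dec (IsFlat (rk M) X × loops ⊆ X × rk M X ≡ k)
  flatOfRank? k X = isFlat? (rk M) X ×-dec (loops ⊆? X) ×-dec (rk M X ≟ k)

  whitney₁≡∑ : ∀ k → whitney₁ (rk M) k ≡ ℕSum.∑ (λ X → ℕSum.when (flatOfRank? k X) ℤ.∣ μ (rk M) X ∣)
  whitney₁≡∑ k = ℕSum.∑-filter (flatOfRank? k) (λ X → ℤ.∣ μ (rk M) X ∣)

  whitney₁-unique : ∀ {k Z} → IsFlat (rk M) Z → loops ⊆ Z → rk M Z ≡ k →
                    (∀ {X} → IsFlat (rk M) X → loops ⊆ X → rk M X ≡ k → X ≡ Z) →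
                    whitney₁ (rk M) k ≡ ℤ.∣ closureSum Z ∣
  whitney₁-unique {k} {Z} flat loops⊆Z rkZ unique = begin
    whitney₁ (rk M) k
      ≡⟨ whitney₁≡∑ k ⟩
    ℕSum.∑ (λ X → ℕSum.when (flatOfRank? k X) ℤ.∣ μ (rk M) X ∣)
      ≡⟨ ℕSum.∑-supported Z _ (λ X X≢Z →
           ℕSum.when-false (flatOfRank? k X) (λ (flatX , loops⊆X , rkX) → X≢Z (unique flatX loops⊆X rkX)) _) ⟩
    ℕSum.when (flatOfRank? k Z) ℤ.∣ μ (rk M) Z ∣
      ≡⟨ ℕSum.when-true (flatOfRank? k Z) (flat , loops⊆Z , rkZ) _ ⟩
    ℤ.∣ μ (rk M) Z ∣
      ≡⟨ ≡.cong ℤ.∣_∣ (μ≡closureSum flat loops⊆Z) ⟩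
    ℤ.∣ closureSum Z ∣ ∎

  whitney₁-zero : whitney₁ (rk M) 0 ≡ 1
  whitney₁-zero = ≡.trans
    (whitney₁-unique (closure-isFlat ⊥) (λ e∈ → e∈) (≡.trans (rk-closure ⊥) rk-∅)
                     (λ _ loops⊆X rkX → ⊆-antisym (rank-0⇒⊆loops rkX) loops⊆X))
    (≡.cong ℤ.∣_∣ closureSum-loops)

  whitney₁-rank : whitney₁ (rk M) (rank M) ≡ ℤ.∣ closureSum ⊤ ∣
  whitney₁-rank = whitney₁-unique (λ e e∉⊤ → ⊥-elim (e∉⊤ ∈⊤)) ⊆⊤ ≡.refl
                                  (λ flat _ full → flat-of-full-rank flat full)

-- Truncation

⊓-submodular : ∀ {u i x y} c → u + i ≤ x + y → i ≤ x → i ≤ y → u ⊓ c + i ⊓ c ≤ x ⊓ c + y ⊓ c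
⊓-submodular {u} {i} {x} {y} c submod i≤x i≤y with ℕP.≤-total x c | ℕP.≤-total y c
... | inj₁ x≤c | inj₁ y≤c rewrite ℕP.m≤n⇒m⊓n≡m x≤c | ℕP.m≤n⇒m⊓n≡m y≤c =
  ℕP.≤-trans (ℕP.+-mono-≤ (ℕP.m⊓n≤m u c) (ℕP.m⊓n≤m i c)) submod
... | inj₂ c≤x | inj₁ y≤c rewrite ℕP.m≥n⇒m⊓n≡n c≤x | ℕP.m≤n⇒m⊓n≡m y≤c =
  ℕP.+-mono-≤ (ℕP.m⊓n≤n u c) (ℕP.≤-trans (ℕP.m⊓n≤m i c) i≤y)
... | inj₁ x≤c | inj₂ c≤y rewrite ℕP.m≤n⇒m⊓n≡m x≤c | ℕP.m≥n⇒m⊓n≡n c≤y =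
  ℕP.≤-trans (ℕP.+-mono-≤ (ℕP.m⊓n≤n u c) (ℕP.≤-trans (ℕP.m⊓n≤m i c) i≤x)) (ℕP.≤-reflexive (ℕP.+-comm c x))
... | inj₂ c≤x | inj₂ c≤y rewrite ℕP.m≥n⇒m⊓n≡n c≤x | ℕP.m≥n⇒m⊓n≡n c≤y =
  ℕP.+-mono-≤ (ℕP.m⊓n≤n u c) (ℕP.m⊓n≤n i c)

truncRk≡⊓ : ∀ {m} (M : Matroid m) k X → truncRk M k X ≡ rk M X ⊓ (rank M ∸ k)
truncRk≡⊓ M k X with (rank M ∸ k) ≤? rk M X
... | yes r-k≤rkX = ≡.sym (ℕP.m≥n⇒m⊓n≡n r-k≤rkX)
... | no  r-k≰rkX = ≡.sym (ℕP.m≤n⇒m⊓n≡m (ℕP.≰⇒≥ r-k≰rkX))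

truncation : ∀ {m} → Matroid m → ℕ → Matroid m
truncation M k = record
  { rk         = truncRk M k
  ; rk-bounded = λ X → ≡.subst (_≤ ∣ X ∣) (≡.sym (trunc X)) (ℕP.≤-trans (ℕP.m⊓n≤m _ c) (rk-bounded M X))
  ; rk-mono    = λ {X} {Y} X⊆Y → ≡.subst₂ _≤_ (≡.sym (trunc X)) (≡.sym (trunc Y)) (ℕP.⊓-monoˡ-≤ c (rk-mono M X⊆Y))
  ; rk-submod  = λ X Y → ≡.subst₂ _≤_ (≡.sym (≡.cong₂ _+_ (trunc (X ∪ Y)) (trunc (X ∩ Y))))
                                      (≡.sym (≡.cong₂ _+_ (trunc X) (trunc Y)))
                   (⊓-submodular c (rk-submod M X Y) (rk-mono M (p∩q⊆p X Y)) (rk-mono M (p∩q⊆q X Y)))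
  }
  where
  c = rank M ∸ k
  trunc = truncRk≡⊓ M k

module TruncationBelowRank {m} (M : Matroid m) {n} (0<n : 0 < n) (n<r : n < rank M) where
  open MatroidClosure M
  open Whitney M
  open import Algebra.Properties.AbelianGroup ℤP.+-0-abelianGroup using (inverseˡ-unique; inverseʳ-unique)

  T : Matroid m
  T = truncation M (rank M ∸ n)

  module CT = MatroidClosure T
  module WT = Whitney T

  rk-T : ∀ X → rk T X ≡ rk M X ⊓ n
  rk-T X = ≡.trans (truncRk≡⊓ M (rank M ∸ n) X) (≡.cong (rk M X ⊓_) (ℕP.m∸[m∸n]≡n (ℕP.<⇒≤ n<r)))

  rank-T : rank T ≡ n
  rank-T = ≡.trans (rk-T ⊤) (ℕP.m≥n⇒m⊓n≡n (ℕP.<⇒≤ n<r))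

  rk-T-low : ∀ {X} → rk M X ≤ n → rk T X ≡ rk M X
  rk-T-low rkX≤n = ≡.trans (rk-T _) (ℕP.m≤n⇒m⊓n≡m rkX≤n)

  rk-T-high : ∀ {X} → n ≤ rk M X → rk T X ≡ n
  rk-T-high n≤rkX = ≡.trans (rk-T _) (ℕP.m≥n⇒m⊓n≡n n≤rkX)

  -- loops are determined by sets of rank ≤ 1, whose rank the truncation keeps as n ≥ 1
  loops-T : CT.loops ≡ loops
  loops-T = closure-cong {r = rk T} {s = rk M} {X = ⊥} (rk-T-low (ℕP.≤-trans (ℕP.≤-reflexive rk-∅) z≤n))
    (λ e → rk-T-low (ℕP.≤-trans (rk-insert-≤ ⊥ e) (ℕP.≤-trans (ℕP.≤-reflexive (≡.cong suc rk-∅)) 0<n)))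

  closure-T≡⊤⇔ : ∀ A → (CT.cl A ≡ ⊤ → n ≤ rk M A) × (n ≤ rk M A → CT.cl A ≡ ⊤)
  closure-T≡⊤⇔ A = to , from
    where
    to : CT.cl A ≡ ⊤ → n ≤ rk M A
    to clA≡⊤ = begin
      n                ≡⟨ ≡.sym (≡.trans (≡.cong (rk T) clA≡⊤) rank-T) ⟩
      rk T (CT.cl A)   ≡⟨ CT.rk-closure A ⟩
      rk T A           ≡⟨ rk-T A ⟩
      rk M A ⊓ n       ≤⟨ ℕP.m⊓n≤m _ n ⟩
      rk M A           ∎
      where open ℕP.≤-Reasoning
    from : n ≤ rk M A → CT.cl A ≡ ⊤
    from n≤rkA = ⊆-antisym ⊆⊤ (λ {e} _ → ∈-closure⁺ (rk T)
      (≡.trans (rk-T-high (ℕP.≤-trans n≤rkA (rk-mono M (⊆-insert A e)))) (≡.sym (rk-T-high n≤rkA))))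

  closureSum-T-⊤ : WT.closureSum ⊤ ≡ ∑ (λ A → when (n ≤? rk M A) (weight A))
  closureSum-T-⊤ = ∑-cong (λ A → ≡.trans (when-× (CT.cl A ≟ˢ ⊤) (WT.loopless? A) _) (≡.trans
    (when-⇔ (CT.cl A ≟ˢ ⊤ ×-dec WT.loopless? A) (n ≤? rk M A ×-dec loopless? A)
       (λ (clA≡⊤ , ll) → proj₁ (closure-T≡⊤⇔ A) clA≡⊤ , ≡.subst (λ L → ∀ e → e ∈ A → e ∉ L) loops-T ll)
       (λ (n≤rkA , ll) → proj₂ (closure-T≡⊤⇔ A) n≤rkA , ≡.subst (λ L → ∀ e → e ∈ A → e ∉ L) (≡.sym loops-T) ll)
       _)
    (≡.sym (when-× (n ≤? rk M A) (loopless? A) _))))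

  a : Fin m
  a = proj₁ (nonloop (ℕP.<-trans 0<n n<r))

  a∉loops : a ∉ loops
  a∉loops = proj₂ (nonloop (ℕP.<-trans 0<n n<r))

  H : ℤ
  H = ∑ (λ Y → when (flatOfRank? n Y ×-dec a ∈? Y) (closureSum Y))

  ∑-high+∑-low≡0 : ∑ (λ A → when (n ≤? rk M A) (weight A)) ℤ.+ ∑ (λ A → when (rk M A <? n) (weight A)) ≡ + 0
  ∑-high+∑-low≡0 = begin
    ∑ (λ A → when (n ≤? rk M A) (weight A)) ℤ.+ ∑ (λ A → when (rk M A <? n) (weight A))
      ≡⟨ ≡.sym (∑-distrib (λ A → when (n ≤? rk M A) (weight A)) (λ A → when (rk M A <? n) (weight A))) ⟩
    ∑ (λ A → when (n ≤? rk M A) (weight A) ℤ.+ when (rk M A <? n) (weight A))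
      ≡⟨ ≡.sym (∑-cong (λ A → when-⊎ (yes tt) (n ≤? rk M A) (rk M A <? n)
                                 (λ _ → ℕP.≤-<-connex n (rk M A)) _ _ ℕP.≤⇒≯ (weight A))) ⟩
    ∑ weight
      ≡⟨ ∑-weight≡0 a∉loops (λ _ → yes tt) _ _ ⟩
    + 0 ∎
    where open ≡.≡-Reasoning

  when-rk-insert≤ : ∀ A v →
    when (rk M (A ∪ ⁅ a ⁆) ≤? n) v ≡ when (rk M A <? n) v ℤ.+ when (rk M A ≟ n ×-dec a ∈? cl A) v
  when-rk-insert≤ A = when-⊎ (rk M (A ∪ ⁅ a ⁆) ≤? n) (rk M A <? n) (rk M A ≟ n ×-dec a ∈? cl A)
    split
    (λ rkA<n → ℕP.≤-trans (rk-insert-≤ A a) rkA<n)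
    (λ (rkA≡n , a∈clA) → ℕP.≤-reflexive (≡.trans (∈-closure⁻ (rk M) a∈clA) rkA≡n))
    (λ rkA<n (rkA≡n , _) → ℕP.<-irrefl rkA≡n rkA<n)
    where
    rkA≤rkA+a = rk-mono M (⊆-insert A a)
    split : rk M (A ∪ ⁅ a ⁆) ≤ n → rk M A < n ⊎ (rk M A ≡ n × a ∈ cl A)
    split rkA+a≤n with rk M A <? n
    ... | yes rkA<n = inj₁ rkA<n
    ... | no  rkA≮n = inj₂ (rkA≡n , ∈-closure⁺ (rk M) (ℕP.≤-antisym (ℕP.≤-trans rkA+a≤n (ℕP.≤-reflexive (≡.sym rkA≡n))) rkA≤rkA+a))
      where rkA≡n = ℕP.≤-antisym (ℕP.≤-trans rkA≤rkA+a rkA+a≤n) (ℕP.≮⇒≥ rkA≮n)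

  ∑-low+∑-onFlat≡0 : ∑ (λ A → when (rk M A <? n) (weight A)) ℤ.+ ∑ (λ A → when (rk M A ≟ n ×-dec a ∈? cl A) (weight A)) ≡ + 0
  ∑-low+∑-onFlat≡0 = begin
    ∑ (λ A → when (rk M A <? n) (weight A)) ℤ.+ ∑ (λ A → when (rk M A ≟ n ×-dec a ∈? cl A) (weight A))
      ≡⟨ ≡.sym (∑-distrib (λ A → when (rk M A <? n) (weight A)) (λ A → when (rk M A ≟ n ×-dec a ∈? cl A) (weight A))) ⟩
    ∑ (λ A → when (rk M A <? n) (weight A) ℤ.+ when (rk M A ≟ n ×-dec a ∈? cl A) (weight A))
      ≡⟨ ≡.sym (∑-cong (λ A → when-rk-insert≤ A (weight A))) ⟩
    ∑ (λ A → when (rk M (A ∪ ⁅ a ⁆) ≤? n) (weight A))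
      ≡⟨ ∑-weight≡0 a∉loops (λ A → rk M (A ∪ ⁅ a ⁆) ≤? n)
           (λ A _ → ℕP.≤-trans (ℕP.≤-reflexive (rk-insert-∈ (∈-insert A a))))
           (λ A _ → ℕP.≤-trans (ℕP.≤-reflexive (≡.sym (rk-insert-∈ (∈-insert A a))))) ⟩
    + 0 ∎
    where open ≡.≡-Reasoning

  ∑-onFlat≡H : ∑ (λ A → when (rk M A ≟ n ×-dec a ∈? cl A) (weight A)) ≡ H
  ∑-onFlat≡H = ≡.sym (≡.trans (∑-closureSum (λ Y → flatOfRank? n Y ×-dec a ∈? Y)) (∑-cong (λ A →
    when-⇔ (flatOfRank? n (cl A) ×-dec a ∈? cl A) (rk M A ≟ n ×-dec a ∈? cl A)
      (λ ((_ , _ , rkclA≡n) , a∈clA) → ≡.trans (≡.sym (rk-closure A)) rkclA≡n , a∈clA)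
      (λ (rkA≡n , a∈clA) → (closure-isFlat A , loops⊆closure A , ≡.trans (rk-closure A) rkA≡n) , a∈clA)
      (weight A))))

  closureSum-T-⊤≡H : WT.closureSum ⊤ ≡ H
  closureSum-T-⊤≡H = begin
    WT.closureSum ⊤                              ≡⟨ closureSum-T-⊤ ⟩
    ∑ (λ A → when (n ≤? rk M A) (weight A))      ≡⟨ inverseˡ-unique _ _ ∑-high+∑-low≡0 ⟩
    - ∑ (λ A → when (rk M A <? n) (weight A))    ≡⟨ ≡.sym (inverseʳ-unique _ _ ∑-low+∑-onFlat≡0) ⟩
    ∑ (λ A → when (rk M A ≟ n ×-dec a ∈? cl A) (weight A)) ≡⟨ ∑-onFlat≡H ⟩
    H ∎
    where open ≡.≡-Reasoning

  whitney₁-truncation≤ : whitney₁ (rk T) n ≤ whitney₁ (rk M) n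
  whitney₁-truncation≤ = begin
    whitney₁ (rk T) n
      ≡⟨ ≡.trans (≡.cong (whitney₁ (rk T)) (≡.sym rank-T)) WT.whitney₁-rank ⟩
    ℤ.∣ WT.closureSum ⊤ ∣
      ≡⟨ ≡.cong ℤ.∣_∣ closureSum-T-⊤≡H ⟩
    ℤ.∣ H ∣
      ≤⟨ ∣∑∣≤∑∣∣ (λ Y → when (flatOfRank? n Y ×-dec a ∈? Y) (closureSum Y)) ⟩
    ℕSum.∑ (λ Y → ℤ.∣ when (flatOfRank? n Y ×-dec a ∈? Y) (closureSum Y) ∣)
      ≤⟨ ∑-mono-≤ bound ⟩
    ℕSum.∑ (λ Y → ℕSum.when (flatOfRank? n Y) ℤ.∣ μ (rk M) Y ∣)
      ≡⟨ ≡.sym (whitney₁≡∑ n) ⟩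
    whitney₁ (rk M) n ∎
    where
    open ℕP.≤-Reasoning
    bound : ∀ Y → ℤ.∣ when (flatOfRank? n Y ×-dec a ∈? Y) (closureSum Y) ∣ ≤ ℕSum.when (flatOfRank? n Y) ℤ.∣ μ (rk M) Y ∣
    bound Y with flatOfRank? n Y
    ... | yes (flatY , loops⊆Y , _) rewrite μ≡closureSum flatY loops⊆Y = ∣when∣≤∣∣ (yes _ ×-dec a ∈? Y) _
    ... | no  _ = z≤n

lemma9 : ∀ {m} (M : Matroid m) (n : ℕ) → n < rank M →
           whitney₁ (rk M) n ≥ whitney₁ (truncRk M (rank M ∸ n)) n
lemma9 M zero    _   =
  ℕP.≤-reflexive (≡.trans (Whitney.whitney₁-zero (truncation M (rank M ∸ 0))) (≡.sym (Whitney.whitney₁-zero M)))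
lemma9 M (suc n) n<r = TruncationBelowRank.whitney₁-truncation≤ M (s≤s z≤n) n<r
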